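{- Suppose that $d\geq 1$ and $n\geq\binom{d}{2}$ are integers. Then the smallest eigenvalue of the adjacency matrix of $\mathrm{SR}(d,n)$ is $-\binom{d}{2}$.
   Context: $\mathrm{SR}(d,n)$ has vertex set $V(d,n)=\{x\in\mathbb{Z}_{\ge0}^d:\sum_i x_i=n\}$, with two vertices adjacent if they differ in exactly two coordinates. -}

module Defs where

open import Level using (0ℓ)
open import Data.Nat using (ℕ; zero; suc; _∸_)
open import Data.Nat.Combinatorics using (_C_)
open import Data.Bool using (Bool; true; false; if_then_else_)
open import Data.List using (List; []; _∷_; [_]; map; concatMap; upTo; foldr)
open import Data.List.Membership.Propositional using (_∈_)
open import Data.Vec using (Vec; []; _∷_)
open import Data.Product using (Σ; ∃; _×_; _,_)
open import Relation.Nullary using (¬_; does)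
open import Relation.Binary.Structures using (IsTotalOrder)
open import Algebra.Bundles using (CommutativeRing)
import Data.Nat as ℕ

-- Ordered fields (the standard library has no reals; we state the
-- spectral claim over an arbitrary ordered field, ℝ being one instance).

record OrderedField : Set₁ where
  field
    commutativeRing : CommutativeRing 0ℓ 0ℓ
  open CommutativeRing commutativeRing public
  infix 4 _≤_
  field
    _≤_          : Carrier → Carrier → Set
    isTotalOrder : IsTotalOrder _≈_ _≤_
    +-mono-≤     : ∀ {a b} c → a ≤ b → a + c ≤ b + c
    *-nonneg     : ∀ {a b} → 0# ≤ a → 0# ≤ b → 0# ≤ a * b
    nontrivial   : ¬ (1# ≈ 0#)
    inverse      : ∀ x → ¬ (x ≈ 0#) → ∃ λ y → x * y ≈ 1#

-- The vertex set V(d,n) = { x ∈ ℕ^d : Σ x_i = n }, enumerated as a list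
-- (without repetitions).

compositions : (d n : ℕ) → List (Vec ℕ d)
compositions zero zero    = [ [] ]
compositions zero (suc n) = []
compositions (suc d) n    =
  concatMap (λ k → map (k ∷_) (compositions d (n ∸ k))) (upTo (suc n))

diffCount : ∀ {d} → Vec ℕ d → Vec ℕ d → ℕ
diffCount []       []       = 0
diffCount (a ∷ xs) (b ∷ ys) =
  if does (a ℕ.≟ b) then diffCount xs ys else suc (diffCount xs ys)

adjacent : ∀ {d} → Vec ℕ d → Vec ℕ d → Bool
adjacent x y = does (diffCount x y ℕ.≟ 2)

module _ (F : OrderedField) where
  open OrderedField F

  ιℕ : ℕ → Carrier
  ιℕ zero    = 0#
  ιℕ (suc n) = 1# + ιℕ n

  adjMatrix : ∀ {d} → Vec ℕ d → Vec ℕ d → Carrier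
  adjMatrix x y = if adjacent x y then 1# else 0#

  adjApply : (d n : ℕ) → (Vec ℕ d → Carrier) → Vec ℕ d → Carrier
  adjApply d n v x = foldr (λ y acc → adjMatrix x y * v y + acc) 0# (compositions d n)

  IsEigenvalueSR : (d n : ℕ) → Carrier → Set
  IsEigenvalueSR d n μ =
    Σ (Vec ℕ d → Carrier) λ v →
      (∃ λ x → x ∈ compositions d n × ¬ (v x ≈ 0#)) ×
      (∀ x → x ∈ compositions d n → adjApply d n v x ≈ μ * v x)

  IsSmallestEigenvalueSR : (d n : ℕ) → Carrier → Set
  IsSmallestEigenvalueSR d n μ =
    IsEigenvalueSR d n μ × (∀ μ′ → IsEigenvalueSR d n μ′ → μ ≤ μ′)

-- Let P_{ij} (i < j) be the 0/1 matrix on V(d,n) of the equivalence relation "x and y agree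
-- outside coordinates i and j". Two distinct vertices agree outside exactly one pair iff they
-- are adjacent, and a vertex agrees with itself outside all C(d,2) pairs, so
-- A + C(d,2)·I = Σ_{i<j} P_{ij}. Each P_{ij} is block diagonal with all-ones blocks, hence
-- positive semidefinite, and the Rayleigh quotient gives every eigenvalue ≥ −C(d,2).
-- Conversely, the Vandermonde sign x ↦ Π_{i<j} sign(x_j − x_i) is alternating, and each
-- P_{ij}-class is mapped to itself by swapping x_i and x_j, so P_{ij} kills it: it is an
-- eigenvector for −C(d,2). It is nonzero on the staircase (0, 1, …, d−2, n − C(d,2) + d − 1),
-- which lies in V(d,n) because n ≥ C(d,2).

module Submission where

open import Defs
open import Algebra.Bundles using (CommutativeSemiring)
open import Data.Bool using (Bool; true; false; _∧_; if_then_else_; T)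
open import Data.Empty using (⊥-elim)
import Data.Fin as Fin
open import Data.List using (List; []; _∷_; _++_; length; map; concatMap; upTo; applyUpTo; foldr; filter)
open import Data.List.Membership.Propositional using (_∈_; find; lose)
open import Data.List.Membership.Propositional.Properties
  using (∈-concatMap⁻; ∈-concatMap⁺; ∈-map⁻; ∈-map⁺; ∈-upTo⁻; ∈-upTo⁺; ∈-filter⁻)
open import Data.List.Properties using (length-filter; filter-reject)
open import Data.List.Relation.Unary.Any using (here; there)
open import Data.Nat using (ℕ; zero; suc)
import Data.Nat as Nat
open import Data.Nat.Combinatorics using (_C_; nCk+nC[k+1]≡[n+1]C[k+1]; nC1≡n)
import Data.Nat.Properties as Natₚ
open import Data.Nat.Tactic.RingSolver using (solve-∀)
open import Data.Product using (_,_; _×_; proj₁; proj₂)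
open import Data.Sum using (inj₁; inj₂)
open import Data.Unit using (⊤)
open import Data.Vec using (Vec; []; _∷_; sum; head; tail; _[_]≔_)
open import Data.Vec.Properties using (≡-dec)
open import Data.Vec.Relation.Unary.All as All using (All; []; _∷_)
open import Function using (id; _∘_; case_of_)
open import Relation.Binary.Definitions using (DecidableEquality)
import Relation.Binary.PropositionalEquality as ≡
open import Relation.Binary.Structures using (IsTotalOrder)
open import Relation.Nullary using (does; yes; no; ¬?)
open import Relation.Nullary.Decidable using (dec-true; dec-false)
open import Relation.Unary using (Pred; Decidable)
open ≡ using (_≡_; _≢_)

module Compositions where

  open ≡ using (refl; sym; trans; cong; subst; module ≡-Reasoning)
  open Nat using (_+_; _*_; _∸_; _≡ᵇ_; _≤ᵇ_; s≤s; s≤s⁻¹)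
  open Natₚ using (m+[n∸m]≡n; m+n∸m≡n; m≤m+n; ≡ᵇ⇒≡; ≡⇒≡ᵇ; +-cancelˡ-≡; +-cancelʳ-≡; suc-injective)

  _≟ᵥ_ : ∀ {d} → DecidableEquality (Vec ℕ d)
  _≟ᵥ_ = ≡-dec Nat._≟_

  ∈-compositions⁻ : ∀ d n {x : Vec ℕ d} → x ∈ compositions d n → sum x ≡ n
  ∈-compositions⁻ zero zero {[]} _ = refl
  ∈-compositions⁻ (suc d) n x∈ with find (∈-concatMap⁻
      (λ k → map (k ∷_) (compositions d (n ∸ k))) {xs = upTo (suc n)} x∈)
  ... | k , k∈ , x∈′ with ∈-map⁻ (k ∷_) x∈′
  ... | y , y∈ , refl = begin
      k + sum y   ≡⟨ cong (k +_) (∈-compositions⁻ d (n ∸ k) y∈) ⟩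
      k + (n ∸ k) ≡⟨ m+[n∸m]≡n (s≤s⁻¹ (∈-upTo⁻ k∈)) ⟩
      n           ∎
    where open ≡-Reasoning

  ∈-compositions⁺ : ∀ d n (x : Vec ℕ d) → sum x ≡ n → x ∈ compositions d n
  ∈-compositions⁺ zero .0 [] refl = here refl
  ∈-compositions⁺ (suc d) n (a ∷ y) refl =
    ∈-concatMap⁺ (λ k → map (k ∷_) (compositions d (n ∸ k))) {xs = upTo (suc n)}
      (lose (∈-upTo⁺ (s≤s (m≤m+n a (sum y))))
            (∈-map⁺ (a ∷_) (∈-compositions⁺ d (n ∸ a) y (sym (m+n∸m≡n a (sum y))))))

  ≟ᵥ-diffCount : ∀ {d} (x y : Vec ℕ d) → does (x ≟ᵥ y) ≡ (diffCount x y ≡ᵇ 0)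
  ≟ᵥ-diffCount [] [] = refl
  ≟ᵥ-diffCount (a ∷ x) (b ∷ y) with a ≡ᵇ b
  ... | true  = ≟ᵥ-diffCount x y
  ... | false = refl

  diffCount≡0⇒≡ : ∀ {d} (x y : Vec ℕ d) → diffCount x y ≡ 0 → x ≡ y
  diffCount≡0⇒≡ x y eq with x ≟ᵥ y | ≟ᵥ-diffCount x y
  ... | yes x≡y | _ = x≡y
  ... | no _    | e rewrite eq = case e of λ ()

  diffCount≢1 : ∀ {d} (x y : Vec ℕ d) → sum x ≡ sum y → diffCount x y ≢ 1
  diffCount≢1 [] [] _ ()
  diffCount≢1 (a ∷ x) (b ∷ y) eq with a ≡ᵇ b in a≡ᵇb
  ... | true with refl ← ≡ᵇ⇒≡ a b (subst T (sym a≡ᵇb) _) = diffCount≢1 x y (+-cancelˡ-≡ a _ _ eq)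
  ... | false = λ e → case diffCount≡0⇒≡ x y (suc-injective e) of λ where
    refl → case +-cancelʳ-≡ (sum x) a b eq of λ where
      refl → subst T a≡ᵇb (≡⇒≡ᵇ a a refl)

  m≤ᵇn∧k≡ᵇn∸m≡m+k≡ᵇn : ∀ m n k → (m ≤ᵇ n) ∧ (k ≡ᵇ n ∸ m) ≡ (m + k ≡ᵇ n)
  m≤ᵇn∧k≡ᵇn∸m≡m+k≡ᵇn zero          n       k = refl
  m≤ᵇn∧k≡ᵇn∸m≡m+k≡ᵇn (suc m)       zero    k = refl
  m≤ᵇn∧k≡ᵇn∸m≡m+k≡ᵇn (suc zero)    (suc n) k = refl
  m≤ᵇn∧k≡ᵇn∸m≡m+k≡ᵇn (suc (suc m)) (suc n) k = m≤ᵇn∧k≡ᵇn∸m≡m+k≡ᵇn (suc m) n k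

  ∸-∸-comm : ∀ m n o → m ∸ n ∸ o ≡ m ∸ o ∸ n
  ∸-∸-comm m n o = begin
    m ∸ n ∸ o     ≡⟨ Natₚ.∸-+-assoc m n o ⟩
    m ∸ (n + o)   ≡⟨ cong (m ∸_) (Natₚ.+-comm n o) ⟩
    m ∸ (o + n)   ≡⟨ Natₚ.∸-+-assoc m o n ⟨
    m ∸ o ∸ n     ∎
    where open ≡-Reasoning

  [1+n]C2≡n+nC2 : ∀ n → suc n C 2 ≡ n + n C 2
  [1+n]C2≡n+nC2 n = trans (sym (nCk+nC[k+1]≡[n+1]C[k+1] n 1)) (cong (_+ n C 2) (nC1≡n n))

  staircase : (d c m : ℕ) → Vec ℕ (suc d)
  staircase zero    c m = c + m ∷ []
  staircase (suc d) c m = c ∷ staircase d (suc c) m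

  staircase-≥ : ∀ d c m → All (c Nat.≤_) (staircase d c m)
  staircase-≥ zero    c m = m≤m+n c m ∷ []
  staircase-≥ (suc d) c m = Natₚ.≤-refl ∷ All.map (Natₚ.≤-trans (Natₚ.n≤1+n c)) (staircase-≥ d (suc c) m)

  sum-staircase : ∀ d c m → sum (staircase d c m) ≡ suc d * c + suc d C 2 + m
  sum-staircase zero c m = lemma c m
    where
    lemma : ∀ c m → c + m + 0 ≡ 1 * c + 0 + m
    lemma = solve-∀
  sum-staircase (suc d) c m = begin
    c + sum (staircase d (suc c) m)       ≡⟨ cong (c +_) (sum-staircase d (suc c) m) ⟩
    c + (suc d * suc c + suc d C 2 + m)   ≡⟨ regroup d c (suc d C 2) m ⟩
    suc (suc d) * c + (suc d + suc d C 2) + m ≡⟨ cong (λ k → suc (suc d) * c + k + m) (sym ([1+n]C2≡n+nC2 (suc d))) ⟩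
    suc (suc d) * c + suc (suc d) C 2 + m ∎
    where
    open ≡-Reasoning
    regroup : ∀ d c k m → c + (suc d * suc c + k + m) ≡ suc (suc d) * c + (suc d + k) + m
    regroup = solve-∀

  staircase∈compositions : ∀ d n → suc d C 2 Nat.≤ n → staircase d 0 (n ∸ suc d C 2) ∈ compositions (suc d) n
  staircase∈compositions d n k≤n = ∈-compositions⁺ (suc d) n _ (begin
    sum (staircase d 0 (n ∸ k))    ≡⟨ sum-staircase d 0 (n ∸ k) ⟩
    suc d * 0 + k + (n ∸ k)        ≡⟨ cong (λ z → z + k + (n ∸ k)) (Natₚ.*-zeroʳ d) ⟩
    k + (n ∸ k)                    ≡⟨ m+[n∸m]≡n k≤n ⟩
    n                              ∎)
    where
    open ≡-Reasoning
    k = suc d C 2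

module Sums {c ℓ} (R : CommutativeSemiring c ℓ) where

  open CommutativeSemiring R
  open import Relation.Binary.Reasoning.Setoid setoid
  open import Algebra.Properties.CommutativeSemigroup +-commutativeSemigroup using (interchange; x∙yz≈y∙xz)
  open Nat using (_∸_; _≡ᵇ_; _≤ᵇ_; _<ᵇ_)

  ∑ : ∀ {a} {A : Set a} → List A → (A → Carrier) → Carrier
  ∑ L g = foldr (λ y acc → g y + acc) 0# L

  syntax ∑ L (λ x → g) = ∑[ x ← L ] g

  ∑< : ℕ → (ℕ → Carrier) → Carrier
  ∑< zero    g = 0#
  ∑< (suc m) g = g 0 + ∑< m (λ t → g (suc t))

  syntax ∑< m (λ t → g) = ∑[ t < m ] g

  𝟙 : Bool → Carrier
  𝟙 b = if b then 1# else 0#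

  module _ {a} {A : Set a} where

    ∑-cong : ∀ (L : List A) {g h : A → Carrier} → (∀ y → g y ≈ h y) → ∑ L g ≈ ∑ L h
    ∑-cong []      g≈h = refl
    ∑-cong (y ∷ L) g≈h = +-cong (g≈h y) (∑-cong L g≈h)

    ∑-cong-∈ : ∀ (L : List A) {g h : A → Carrier} → (∀ {y} → y ∈ L → g y ≈ h y) → ∑ L g ≈ ∑ L h
    ∑-cong-∈ []      g≈h = refl
    ∑-cong-∈ (y ∷ L) g≈h = +-cong (g≈h (here ≡.refl)) (∑-cong-∈ L (g≈h ∘ there))

    ∑-zero : ∀ (L : List A) {g : A → Carrier} → (∀ {y} → y ∈ L → g y ≈ 0#) → ∑ L g ≈ 0#
    ∑-zero []      g≈0 = refl
    ∑-zero (y ∷ L) g≈0 = trans (+-cong (g≈0 (here ≡.refl)) (∑-zero L (g≈0 ∘ there))) (+-identityˡ 0#)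

    ∑-++ : ∀ (L M : List A) (g : A → Carrier) → ∑ (L ++ M) g ≈ ∑ L g + ∑ M g
    ∑-++ []      M g = sym (+-identityˡ _)
    ∑-++ (y ∷ L) M g = trans (+-congˡ (∑-++ L M g)) (sym (+-assoc _ _ _))

    ∑-distrib-+ : ∀ (L : List A) (g h : A → Carrier) → ∑[ y ← L ] (g y + h y) ≈ ∑ L g + ∑ L h
    ∑-distrib-+ []      g h = sym (+-identityˡ _)
    ∑-distrib-+ (y ∷ L) g h = trans (+-congˡ (∑-distrib-+ L g h)) (interchange _ _ _ _)

    ∑-distribˡ : ∀ (L : List A) c (g : A → Carrier) → ∑[ y ← L ] (c * g y) ≈ c * ∑ L g
    ∑-distribˡ []      c g = sym (zeroʳ c)
    ∑-distribˡ (y ∷ L) c g = trans (+-congˡ (∑-distribˡ L c g)) (sym (distribˡ c _ _))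

    ∑-distribʳ : ∀ (L : List A) c (g : A → Carrier) → ∑[ y ← L ] (g y * c) ≈ ∑ L g * c
    ∑-distribʳ L c g = begin
      ∑[ y ← L ] (g y * c) ≈⟨ ∑-cong L (λ y → *-comm (g y) c) ⟩
      ∑[ y ← L ] (c * g y) ≈⟨ ∑-distribˡ L c g ⟩
      c * ∑ L g            ≈⟨ *-comm c _ ⟩
      ∑ L g * c            ∎

    ∑-map : ∀ {b} {B : Set b} (f : B → A) (L : List B) (g : A → Carrier) → ∑ (map f L) g ≡ ∑ L (g ∘ f)
    ∑-map f []      g = ≡.refl
    ∑-map f (y ∷ L) g = ≡.cong (g (f y) +_) (∑-map f L g)

    ∑-concatMap : ∀ {b} {B : Set b} (f : B → List A) (L : List B) (g : A → Carrier) →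
      ∑ (concatMap f L) g ≈ ∑[ z ← L ] ∑ (f z) g
    ∑-concatMap f []      g = refl
    ∑-concatMap f (y ∷ L) g = trans (∑-++ (f y) (concatMap f L) g) (+-congˡ (∑-concatMap f L g))


  ∑-filter : ∀ {a p} {A : Set a} {P : Pred A p} (P? : Decidable P) (L : List A) (g : A → Carrier) →
    ∑ L g ≈ ∑ (filter P? L) g + ∑ (filter (¬? ∘ P?) L) g
  ∑-filter P? []      g = sym (+-identityˡ 0#)
  ∑-filter P? (x ∷ L) g with P? x
  ... | yes _ = trans (+-congˡ (∑-filter P? L g)) (sym (+-assoc _ _ _))
  ... | no  _ = trans (+-congˡ (∑-filter P? L g)) (x∙yz≈y∙xz _ _ _)

  ∑-comm : ∀ {a b} {A : Set a} {B : Set b} (L : List A) (M : List B) (g : A → B → Carrier) →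
    ∑[ x ← L ] ∑[ y ← M ] g x y ≈ ∑[ y ← M ] ∑[ x ← L ] g x y
  ∑-comm []      M g = sym (∑-zero M (λ _ → refl))
  ∑-comm (x ∷ L) M g = trans (+-congˡ (∑-comm L M g)) (sym (∑-distrib-+ M (g x) _))

  ∑-upTo : ∀ m (g : ℕ → Carrier) → ∑ (upTo m) g ≡ ∑< m g
  ∑-upTo m g = go id m
    where
    go : ∀ (f : ℕ → ℕ) m → ∑ (applyUpTo f m) g ≡ ∑< m (g ∘ f)
    go f zero    = ≡.refl
    go f (suc m) = ≡.cong (g (f 0) +_) (go (f ∘ suc) m)

  ∑<-cong : ∀ m {g h : ℕ → Carrier} → (∀ {t} → t Nat.< m → g t ≈ h t) → ∑< m g ≈ ∑< m h
  ∑<-cong zero    g≈h = refl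
  ∑<-cong (suc m) g≈h = +-cong (g≈h (Nat.s≤s Nat.z≤n)) (∑<-cong m (g≈h ∘ Nat.s≤s))

  ∑<-zero : ∀ m {g : ℕ → Carrier} → (∀ t → g t ≈ 0#) → ∑< m g ≈ 0#
  ∑<-zero zero    g≈0 = refl
  ∑<-zero (suc m) g≈0 = trans (+-cong (g≈0 0) (∑<-zero m (g≈0 ∘ suc))) (+-identityˡ 0#)

  ∑<-distribˡ : ∀ m c (g : ℕ → Carrier) → ∑[ t < m ] (c * g t) ≈ c * ∑< m g
  ∑<-distribˡ zero    c g = sym (zeroʳ c)
  ∑<-distribˡ (suc m) c g = trans (+-congˡ (∑<-distribˡ m c _)) (sym (distribˡ c _ _))

  ∑<-snoc : ∀ m (g : ℕ → Carrier) → ∑< (suc m) g ≈ ∑< m g + g m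
  ∑<-snoc zero    g = trans (+-identityʳ _) (sym (+-identityˡ _))
  ∑<-snoc (suc m) g = trans (+-congˡ (∑<-snoc m (g ∘ suc))) (sym (+-assoc _ _ _))

  ∑<-reverse : ∀ m (g : ℕ → Carrier) → ∑< m g ≈ ∑[ t < m ] g (m ∸ suc t)
  ∑<-reverse zero    g = refl
  ∑<-reverse (suc m) g = begin
    g 0 + ∑[ t < m ] g (suc t)                 ≈⟨ +-congˡ (∑<-reverse m (g ∘ suc)) ⟩
    g 0 + ∑[ t < m ] g (suc (m ∸ suc t))        ≈⟨ +-comm _ _ ⟩
    ∑[ t < m ] g (suc (m ∸ suc t)) + g 0        ≈⟨ +-cong (∑<-cong m (λ t<m → reflexive (≡.cong g (≡.sym (Natₚ.+-∸-assoc 1 t<m)))))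
                                                          (reflexive (≡.cong g (≡.sym (Natₚ.n∸n≡0 m)))) ⟩
    ∑[ t < m ] g (m ∸ t) + g (m ∸ m)           ≈⟨ ∑<-snoc m (λ t → g (m ∸ t)) ⟨
    ∑[ t < suc m ] g (m ∸ t)                   ∎

  𝟙-∧ : ∀ p q → 𝟙 (p ∧ q) ≈ 𝟙 p * 𝟙 q
  𝟙-∧ true  q = sym (*-identityˡ _)
  𝟙-∧ false q = sym (zeroˡ _)

  𝟙-∧-* : ∀ p q x → 𝟙 (p ∧ q) * x ≈ 𝟙 p * (𝟙 q * x)
  𝟙-∧-* true  q x = sym (*-identityˡ _)
  𝟙-∧-* false q x = trans (zeroˡ x) (sym (zeroˡ _))

  private
    ≤ᵇ-suc : ∀ a n → (a ≤ᵇ n) ≡ (suc a ≤ᵇ suc n)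
    ≤ᵇ-suc zero    n = ≡.refl
    ≤ᵇ-suc (suc a) n = ≡.refl

  ∑<-sift : ∀ n a (h : ℕ → Carrier) → ∑[ b < suc n ] (𝟙 (a ≡ᵇ b) * h b) ≈ 𝟙 (a ≤ᵇ n) * h a
  ∑<-sift zero    zero    h = +-identityʳ _
  ∑<-sift zero    (suc a) h = trans (+-identityʳ _) (trans (zeroˡ _) (sym (zeroˡ _)))
  ∑<-sift (suc n) zero    h = trans (+-congˡ (∑<-zero (suc n) (λ t → zeroˡ (h (suc t))))) (+-identityʳ _)
  ∑<-sift (suc n) (suc a) h = begin
    0# * h 0 + ∑[ b < suc n ] (𝟙 (a ≡ᵇ b) * h (suc b)) ≈⟨ +-cong (zeroˡ _) (∑<-sift n a (h ∘ suc)) ⟩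
    0# + 𝟙 (a ≤ᵇ n) * h (suc a)                        ≈⟨ +-identityˡ _ ⟩
    𝟙 (a ≤ᵇ n) * h (suc a)                             ≡⟨ ≡.cong (λ b → 𝟙 b * h (suc a)) (≤ᵇ-suc a n) ⟩
    𝟙 (suc a ≤ᵇ suc n) * h (suc a)                     ∎

  ∑<-sift-∸ : ∀ n s (h : ℕ → Carrier) → ∑[ c < suc n ] (𝟙 (s ≡ᵇ n ∸ c) * h c) ≈ 𝟙 (s ≤ᵇ n) * h (n ∸ s)
  ∑<-sift-∸ n s h = begin
    ∑[ c < suc n ] (𝟙 (s ≡ᵇ n ∸ c) * h c)              ≈⟨ ∑<-reverse (suc n) (λ c → 𝟙 (s ≡ᵇ n ∸ c) * h c) ⟩
    ∑[ t < suc n ] (𝟙 (s ≡ᵇ n ∸ (n ∸ t)) * h (n ∸ t))  ≈⟨ ∑<-cong (suc n) (λ {t} t<1+n →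
                                                          reflexive (≡.cong (λ u → 𝟙 (s ≡ᵇ u) * h (n ∸ t))
                                                                            (Natₚ.m∸[m∸n]≡n (Nat.s≤s⁻¹ t<1+n)))) ⟩
    ∑[ t < suc n ] (𝟙 (s ≡ᵇ t) * h (n ∸ t))            ≈⟨ ∑<-sift n s (λ t → h (n ∸ t)) ⟩
    𝟙 (s ≤ᵇ n) * h (n ∸ s)                             ∎

  ∑<-from : ∀ n s (h : ℕ → Carrier) →
    ∑[ t < suc n ] (𝟙 (s ≤ᵇ t) * h t) ≈ 𝟙 (s ≤ᵇ n) * ∑[ u < suc (n ∸ s) ] h (s Nat.+ u)
  ∑<-from n       zero    h = ∑<-distribˡ (suc n) 1# h
  ∑<-from zero    (suc s) h = trans (+-identityʳ _) (trans (zeroˡ _) (sym (zeroˡ _)))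
  ∑<-from (suc n) (suc s) h = begin
    0# * h 0 + ∑[ t < suc n ] (𝟙 (suc s ≤ᵇ suc t) * h (suc t))
      ≈⟨ +-cong (zeroˡ _) (∑<-cong (suc n) (λ {t} _ → reflexive (≡.cong (λ b → 𝟙 b * h (suc t)) (≡.sym (≤ᵇ-suc s t))))) ⟩
    0# + ∑[ t < suc n ] (𝟙 (s ≤ᵇ t) * h (suc t))          ≈⟨ +-identityˡ _ ⟩
    ∑[ t < suc n ] (𝟙 (s ≤ᵇ t) * h (suc t))               ≈⟨ ∑<-from n s (h ∘ suc) ⟩
    𝟙 (s ≤ᵇ n) * ∑[ u < suc (n ∸ s) ] h (suc (s Nat.+ u))
      ≡⟨ ≡.cong (λ b → 𝟙 b * ∑[ u < suc (n ∸ s) ] h (suc (s Nat.+ u))) (≤ᵇ-suc s n) ⟩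
    𝟙 (suc s ≤ᵇ suc n) * ∑[ u < suc (n ∸ s) ] h (suc (s Nat.+ u)) ∎

  ∑<-from-∸ : ∀ n s (h : ℕ → Carrier) →
    ∑[ b < suc n ] (𝟙 (s ≤ᵇ n ∸ b) * h b) ≈ 𝟙 (s ≤ᵇ n) * ∑< (suc (n ∸ s)) h
  ∑<-from-∸ n s h = begin
    ∑[ b < suc n ] (𝟙 (s ≤ᵇ n ∸ b) * h b)              ≈⟨ ∑<-reverse (suc n) (λ b → 𝟙 (s ≤ᵇ n ∸ b) * h b) ⟩
    ∑[ t < suc n ] (𝟙 (s ≤ᵇ n ∸ (n ∸ t)) * h (n ∸ t))  ≈⟨ ∑<-cong (suc n) (λ {t} t<1+n →
                                                          reflexive (≡.cong (λ u → 𝟙 (s ≤ᵇ u) * h (n ∸ t))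
                                                                            (Natₚ.m∸[m∸n]≡n (Nat.s≤s⁻¹ t<1+n)))) ⟩
    ∑[ t < suc n ] (𝟙 (s ≤ᵇ t) * h (n ∸ t))            ≈⟨ ∑<-from n s (λ t → h (n ∸ t)) ⟩
    𝟙 (s ≤ᵇ n) * ∑[ u < suc (n ∸ s) ] h (n ∸ (s Nat.+ u))
      ≈⟨ *-congˡ (∑<-cong (suc (n ∸ s)) (λ {u} _ → reflexive (≡.cong h (≡.sym (Natₚ.∸-+-assoc n s u))))) ⟩
    𝟙 (s ≤ᵇ n) * ∑[ u < suc (n ∸ s) ] h (n ∸ s ∸ u)    ≈⟨ *-congˡ (∑<-reverse (suc (n ∸ s)) h) ⟨
    𝟙 (s ≤ᵇ n) * ∑< (suc (n ∸ s)) h                    ∎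

module OrderedFieldProperties (F : OrderedField) where

  open OrderedField F
  open import Relation.Binary.Reasoning.Setoid setoid
  open IsTotalOrder isTotalOrder public
    using (total; antisym; ≤-respˡ-≈; ≤-respʳ-≈) renaming (reflexive to ≤-reflexive; trans to ≤-trans)
  open import Algebra.Properties.Ring ring public using (-‿distribˡ-*; -‿distribʳ-*; -1*x≈-x)
  open import Algebra.Properties.AbelianGroup +-abelianGroup public using (⁻¹-involutive)

  x≤x+y : ∀ {x y} → 0# ≤ y → x ≤ x + y
  x≤x+y {x} {y} 0≤y = ≤-respˡ-≈ (+-identityˡ x) (≤-respʳ-≈ (+-comm y x) (+-mono-≤ x 0≤y))

  +-nonneg : ∀ {x y} → 0# ≤ x → 0# ≤ y → 0# ≤ x + y
  +-nonneg 0≤x 0≤y = ≤-trans 0≤x (x≤x+y 0≤y)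

  x≤0⇒0≤-x : ∀ {x} → x ≤ 0# → 0# ≤ - x
  x≤0⇒0≤-x {x} x≤0 = ≤-respˡ-≈ (-‿inverseʳ x) (≤-respʳ-≈ (+-identityˡ (- x)) (+-mono-≤ (- x) x≤0))

  -x*-y≈x*y : ∀ x y → (- x) * (- y) ≈ x * y
  -x*-y≈x*y x y = begin
    (- x) * (- y) ≈⟨ -‿distribˡ-* x (- y) ⟨
    - (x * - y)   ≈⟨ -‿cong (-‿distribʳ-* x y) ⟨
    - (- (x * y)) ≈⟨ ⁻¹-involutive (x * y) ⟩
    x * y         ∎

  square-nonneg : ∀ x → 0# ≤ x * x
  square-nonneg x with total 0# x
  ... | inj₁ 0≤x = *-nonneg 0≤x 0≤x
  ... | inj₂ x≤0 = ≤-respʳ-≈ (-x*-y≈x*y x x) (*-nonneg (x≤0⇒0≤-x x≤0) (x≤0⇒0≤-x x≤0))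

  0≤1 : 0# ≤ 1#
  0≤1 = ≤-respʳ-≈ (*-identityˡ 1#) (square-nonneg 1#)

  *-cancelˡ-≈0 : ∀ {x y} → x ≉ 0# → x * y ≈ 0# → y ≈ 0#
  *-cancelˡ-≈0 {x} {y} x≉0 xy≈0 with inverse x x≉0
  ... | x⁻¹ , xx⁻¹≈1 = begin
    y               ≈⟨ *-identityˡ y ⟨
    1# * y          ≈⟨ *-congʳ (trans (sym xx⁻¹≈1) (*-comm x x⁻¹)) ⟩
    (x⁻¹ * x) * y   ≈⟨ *-assoc x⁻¹ x y ⟩
    x⁻¹ * (x * y)   ≈⟨ *-congˡ xy≈0 ⟩
    x⁻¹ * 0#        ≈⟨ zeroʳ x⁻¹ ⟩
    0#              ∎

  1+1≉0 : 1# + 1# ≉ 0#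
  1+1≉0 1+1≈0 = nontrivial (antisym (≤-respʳ-≈ 1+1≈0 (x≤x+y 0≤1)) 0≤1)

  x≈-x⇒x≈0 : ∀ {x} → x ≈ - x → x ≈ 0#
  x≈-x⇒x≈0 {x} x≈-x = *-cancelˡ-≈0 1+1≉0 (begin
    (1# + 1#) * x  ≈⟨ distribʳ x 1# 1# ⟩
    1# * x + 1# * x ≈⟨ +-cong (*-identityˡ x) (*-identityˡ x) ⟩
    x + x          ≈⟨ +-congˡ x≈-x ⟩
    x + - x        ≈⟨ -‿inverseʳ x ⟩
    0#             ∎)

  0≤x+y⇒-y≤x : ∀ {x y} → 0# ≤ x + y → - y ≤ x
  0≤x+y⇒-y≤x {x} {y} 0≤x+y = ≤-respˡ-≈ (+-identityˡ (- y)) (≤-respʳ-≈ x+y-y≈x (+-mono-≤ (- y) 0≤x+y))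
    where
    x+y-y≈x : (x + y) + - y ≈ x
    x+y-y≈x = trans (+-assoc x y (- y)) (trans (+-congˡ (-‿inverseʳ y)) (+-identityʳ x))

  nonneg-*-cancelʳ : ∀ {x y} → 0# ≤ y → y ≉ 0# → 0# ≤ x * y → 0# ≤ x
  nonneg-*-cancelʳ {x} {y} 0≤y y≉0 0≤xy with total 0# x
  ... | inj₁ 0≤x = 0≤x
  ... | inj₂ x≤0 = ≤-reflexive (sym (*-cancelˡ-≈0 y≉0 (trans (*-comm y x) xy≈0)))
    where
    0≤-xy : 0# ≤ - (x * y)
    0≤-xy = ≤-respʳ-≈ (sym (-‿distribˡ-* x y)) (*-nonneg (x≤0⇒0≤-x x≤0) 0≤y)
    xy≤0 : x * y ≤ 0#
    xy≤0 = ≤-respˡ-≈ (+-identityˡ (x * y)) (≤-respʳ-≈ (trans (+-comm _ _) (-‿inverseʳ (x * y))) (+-mono-≤ (x * y) 0≤-xy))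
    xy≈0 : x * y ≈ 0#
    xy≈0 = antisym xy≤0 0≤xy

module OrderedFieldSums (F : OrderedField) where

  open OrderedField F
  open OrderedFieldProperties F
  open Sums commutativeSemiring
  open import Relation.Binary.Reasoning.Setoid setoid

  ∑-nonneg : ∀ {a} {A : Set a} (L : List A) {g : A → Carrier} → (∀ y → 0# ≤ g y) → 0# ≤ ∑ L g
  ∑-nonneg []      0≤g = ≤-reflexive refl
  ∑-nonneg (y ∷ L) 0≤g = +-nonneg (0≤g y) (∑-nonneg L 0≤g)

  ∈⇒≤∑ : ∀ {a} {A : Set a} (L : List A) {g : A → Carrier} → (∀ y → 0# ≤ g y) → ∀ {x} → x ∈ L → g x ≤ ∑ L g
  ∈⇒≤∑ (y ∷ L) 0≤g (here ≡.refl) = x≤x+y (∑-nonneg L 0≤g)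
  ∈⇒≤∑ (y ∷ L) {g} 0≤g (there x∈L) =
    ≤-trans (∈⇒≤∑ L 0≤g x∈L) (≤-respˡ-≈ (+-identityˡ _) (+-mono-≤ (∑ L g) (0≤g y)))

  ∑<-antipalindromic : ∀ n (h : ℕ → Carrier) → (∀ {t} → t Nat.≤ n → h t ≈ - h (n Nat.∸ t)) → ∑< (suc n) h ≈ 0#
  ∑<-antipalindromic n h h-odd = x≈-x⇒x≈0 (begin
    ∑< (suc n) h                       ≈⟨ ∑<-cong (suc n) (h-odd ∘ Nat.s≤s⁻¹) ⟩
    ∑[ t < suc n ] (- h (n Nat.∸ t))   ≈⟨ ∑<-cong (suc n) (λ {t} _ → -1*x≈-x (h (n Nat.∸ t))) ⟨
    ∑[ t < suc n ] (- 1# * h (n Nat.∸ t)) ≈⟨ ∑<-distribˡ (suc n) (- 1#) (λ t → h (n Nat.∸ t)) ⟩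
    - 1# * ∑[ t < suc n ] h (n Nat.∸ t) ≈⟨ -1*x≈-x _ ⟩
    - ∑[ t < suc n ] h (n Nat.∸ t)     ≈⟨ -‿cong (∑<-reverse (suc n) h) ⟨
    - ∑< (suc n) h                     ∎)

  -- The kernel matrix of κ is block diagonal with all-ones blocks (the κ-classes), so its
  -- quadratic form is a sum of squares.
  module KernelForm {a b} {A : Set a} {B : Set b} (κ : A → B) (_≟_ : DecidableEquality B) where

    kernel : A → A → Carrier
    kernel x y = 𝟙 (does (κ x ≟ κ y))

    form : List A → (A → Carrier) → Carrier
    form L v = ∑[ x ← L ] (v x * ∑[ y ← L ] (kernel x y * v y))

    kernel-≡ : ∀ {x y} → κ x ≡ κ y → kernel x y ≡ 1#
    kernel-≡ {x} {y} eq = ≡.cong 𝟙 (dec-true (κ x ≟ κ y) eq)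

    kernel-≢ : ∀ {x y} → κ x ≢ κ y → kernel x y ≡ 0#
    kernel-≢ {x} {y} neq = ≡.cong 𝟙 (dec-false (κ x ≟ κ y) neq)

    sameClass? : (z : A) → Decidable (λ x → κ x ≡ κ z)
    sameClass? z x = κ x ≟ κ z

    form-split : ∀ z L v → let S = ∑ (filter (sameClass? z) L) v in
      form L v ≈ S * S + form (filter (¬? ∘ sameClass? z) L) v
    form-split z L v = begin
      ∑[ x ← L ] (v x * row L x)                              ≈⟨ ∑-filter P? L (λ x → v x * row L x) ⟩
      ∑[ x ← cls ] (v x * row L x) + ∑[ x ← rest ] (v x * row L x)
        ≈⟨ +-cong (∑-cong-∈ cls (*-congˡ ∘ row-cls)) (∑-cong-∈ rest (*-congˡ ∘ row-rest)) ⟩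
      ∑[ x ← cls ] (v x * S) + form rest v                    ≈⟨ +-congʳ (∑-distribʳ cls S v) ⟩
      S * S + form rest v                                     ∎
      where
      P? = sameClass? z
      cls  = filter P? L
      rest = filter (¬? ∘ P?) L
      S = ∑ cls v
      row : List A → A → Carrier
      row M x = ∑[ y ← M ] (kernel x y * v y)
      same-class : ∀ {x y} → x ∈ cls → y ∈ cls → κ x ≡ κ y
      same-class x∈ y∈ = ≡.trans (proj₂ (∈-filter⁻ P? {xs = L} x∈)) (≡.sym (proj₂ (∈-filter⁻ P? {xs = L} y∈)))
      other-class : ∀ {x y} → x ∈ cls → y ∈ rest → κ x ≢ κ y
      other-class x∈ y∈ κx≡κy =
        proj₂ (∈-filter⁻ (¬? ∘ P?) {xs = L} y∈) (≡.trans (≡.sym κx≡κy) (proj₂ (∈-filter⁻ P? {xs = L} x∈)))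
      kernel-1 : ∀ {x y} → κ x ≡ κ y → kernel x y * v y ≈ v y
      kernel-1 eq = trans (reflexive (≡.cong (_* v _) (kernel-≡ eq))) (*-identityˡ _)
      kernel-0 : ∀ {x y} → κ x ≢ κ y → kernel x y * v y ≈ 0#
      kernel-0 neq = trans (reflexive (≡.cong (_* v _) (kernel-≢ neq))) (zeroˡ _)
      row-cls : ∀ {x} → x ∈ cls → row L x ≈ S
      row-cls x∈ = trans (∑-filter P? L _) (trans (+-cong (∑-cong-∈ cls (kernel-1 ∘ same-class x∈))
                                                          (∑-zero rest (kernel-0 ∘ other-class x∈)))
                                                  (+-identityʳ S))
      row-rest : ∀ {x} → x ∈ rest → row L x ≈ row rest x
      row-rest x∈ = trans (∑-filter P? L _) (trans (+-congʳ (∑-zero cls (λ y∈ → kernel-0 (other-class y∈ x∈ ∘ ≡.sym))))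
                                                   (+-identityˡ _))

    form-nonneg : ∀ L v → 0# ≤ form L v
    form-nonneg L v = go (length L) L Natₚ.≤-refl
      where
      go : ∀ n L → length L Nat.≤ n → 0# ≤ form L v
      go n       []          _                = ≤-reflexive refl
      go (suc n) L@(z ∷ L′) (Nat.s≤s |L′|≤n) =
        ≤-respʳ-≈ (sym (form-split z L v)) (+-nonneg (square-nonneg _) (go n rest |rest|≤n))
        where
        rest = filter (¬? ∘ sameClass? z) L
        |rest|≤n : length rest Nat.≤ n
        |rest|≤n rewrite filter-reject (¬? ∘ sameClass? z) {xs = L′} (λ κz≢κz → κz≢κz ≡.refl) =
          Natₚ.≤-trans (length-filter (¬? ∘ sameClass? z) L′) |L′|≤n

  ∑-squares-pos : ∀ {a} {A : Set a} (L : List A) (v : A → Carrier) {x} → x ∈ L → v x ≉ 0# →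
    0# ≤ ∑[ y ← L ] (v y * v y) × ∑[ y ← L ] (v y * v y) ≉ 0#
  ∑-squares-pos L v x∈L vx≉0 = ∑-nonneg L (λ y → square-nonneg (v y)) , λ ∑≈0 →
    vx≉0 (*-cancelˡ-≈0 vx≉0 (antisym (≤-respʳ-≈ ∑≈0 (∈⇒≤∑ L (λ y → square-nonneg (v y)) x∈L)) (square-nonneg _)))

module SR (F : OrderedField) where

  open OrderedField F hiding (zero)
  open OrderedFieldProperties F
  open OrderedFieldSums F
  open Sums commutativeSemiring
  open Compositions
  open import Relation.Binary.Reasoning.Setoid setoid
  open Nat using (_∸_; _≡ᵇ_; _≤ᵇ_; _<ᵇ_)
  open import Algebra.Properties.CommutativeSemigroup *-commutativeSemigroup
    using (x∙yz≈y∙xz) renaming (interchange to *-interchange)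
  open import Algebra.Properties.AbelianGroup +-abelianGroup using (ε⁻¹≈ε)

  ι : ℕ → Carrier
  ι = ιℕ F

  ι-+ : ∀ m n → ι (m Nat.+ n) ≈ ι m + ι n
  ι-+ zero    n = sym (+-identityˡ _)
  ι-+ (suc m) n = trans (+-congˡ (ι-+ m n)) (sym (+-assoc _ _ _))

  -- Projections zero out some coordinates, so κ x ≡ κ y says that x and y agree outside
  -- them; keepHead and dropHead extend κ by keeping or zeroing a new first coordinate.
  Projection : ℕ → Set
  Projection d = Vec ℕ d → Vec ℕ d

  keepHead dropHead : ∀ {d} → Projection d → Projection (suc d)
  keepHead κ x = head x ∷ κ (tail x)
  dropHead κ x = 0 ∷ κ (tail x)

  forgetOne : ∀ d → List (Projection d)
  forgetOne zero    = []
  forgetOne (suc d) = dropHead id ∷ map keepHead (forgetOne d)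

  forgetTwo : ∀ d → List (Projection d)
  forgetTwo zero    = []
  forgetTwo (suc d) = map dropHead (forgetOne d) ++ map keepHead (forgetTwo d)

  agree : ∀ {d} → Projection d → Vec ℕ d → Vec ℕ d → Carrier
  agree κ x y = 𝟙 (does (κ x ≟ᵥ κ y))

  classSum : ∀ {d} (n : ℕ) → Projection d → (Vec ℕ d → Carrier) → Vec ℕ d → Carrier
  classSum n κ g x = ∑[ y ← compositions _ n ] (agree κ x y * g y)

  ∑-compositions-suc : ∀ d n (g : Vec ℕ (suc d) → Carrier) →
    ∑ (compositions (suc d) n) g ≈ ∑[ b < suc n ] ∑[ y ← compositions d (n ∸ b) ] g (b ∷ y)
  ∑-compositions-suc d n g = begin
    ∑ (compositions (suc d) n) g
      ≈⟨ ∑-concatMap (λ b → map (b ∷_) (compositions d (n ∸ b))) (upTo (suc n)) g ⟩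
    ∑[ b ← upTo (suc n) ] ∑ (map (b ∷_) (compositions d (n ∸ b))) g
      ≈⟨ ∑-cong (upTo (suc n)) (λ b → reflexive (∑-map (b ∷_) (compositions d (n ∸ b)) g)) ⟩
    ∑[ b ← upTo (suc n) ] ∑[ y ← compositions d (n ∸ b) ] g (b ∷ y)
      ≡⟨ ∑-upTo (suc n) _ ⟩
    ∑[ b < suc n ] ∑[ y ← compositions d (n ∸ b) ] g (b ∷ y) ∎

  classSum-dropHead : ∀ {d} n (κ : Projection d) g a x →
    classSum n (dropHead κ) g (a ∷ x) ≈ ∑[ b < suc n ] classSum (n ∸ b) κ (g ∘ (b ∷_)) x
  classSum-dropHead {d} n κ g a x = ∑-compositions-suc d n (λ y → agree (dropHead κ) (a ∷ x) y * g y)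

  classSum-keepHead : ∀ {d} n (κ : Projection d) g a x →
    classSum n (keepHead κ) g (a ∷ x) ≈ 𝟙 (a ≤ᵇ n) * classSum (n ∸ a) κ (g ∘ (a ∷_)) x
  classSum-keepHead {d} n κ g a x = begin
    classSum n (keepHead κ) g (a ∷ x)
      ≈⟨ ∑-compositions-suc d n (λ y → agree (keepHead κ) (a ∷ x) y * g y) ⟩
    ∑[ b < suc n ] ∑[ y ← compositions d (n ∸ b) ] (𝟙 ((a ≡ᵇ b) ∧ does (κ x ≟ᵥ κ y)) * g (b ∷ y))
      ≈⟨ ∑<-cong (suc n) (λ {b} _ → trans (∑-cong (compositions d (n ∸ b)) (λ y → 𝟙-∧-* (a ≡ᵇ b) (does (κ x ≟ᵥ κ y)) (g (b ∷ y))))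
                                          (∑-distribˡ (compositions d (n ∸ b)) (𝟙 (a ≡ᵇ b)) (λ y → agree κ x y * g (b ∷ y)))) ⟩
    ∑[ b < suc n ] (𝟙 (a ≡ᵇ b) * classSum (n ∸ b) κ (g ∘ (b ∷_)) x)
      ≈⟨ ∑<-sift n a (λ b → classSum (n ∸ b) κ (g ∘ (b ∷_)) x) ⟩
    𝟙 (a ≤ᵇ n) * classSum (n ∸ a) κ (g ∘ (a ∷_)) x ∎

  classSum-id : ∀ {d} m g (x : Vec ℕ d) → classSum m id g x ≈ 𝟙 (sum x ≡ᵇ m) * g x
  classSum-id zero    g [] = +-identityʳ _
  classSum-id (suc m) g [] = sym (zeroˡ _)
  classSum-id m g (a ∷ x) = begin
    classSum m id g (a ∷ x)
      ≈⟨ ∑-cong (compositions _ m) (λ y → reflexive (≡.cong (λ z → 𝟙 (does ((a ∷ x) ≟ᵥ z)) * g y) (≡.sym (keepHead-id y)))) ⟩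
    classSum m (keepHead id) g (a ∷ x)
      ≈⟨ classSum-keepHead m id g a x ⟩
    𝟙 (a ≤ᵇ m) * classSum (m ∸ a) id (g ∘ (a ∷_)) x
      ≈⟨ *-congˡ (classSum-id (m ∸ a) (g ∘ (a ∷_)) x) ⟩
    𝟙 (a ≤ᵇ m) * (𝟙 (sum x ≡ᵇ m ∸ a) * g (a ∷ x))
      ≈⟨ 𝟙-∧-* (a ≤ᵇ m) (sum x ≡ᵇ m ∸ a) (g (a ∷ x)) ⟨
    𝟙 ((a ≤ᵇ m) ∧ (sum x ≡ᵇ m ∸ a)) * g (a ∷ x)
      ≡⟨ ≡.cong (λ b → 𝟙 b * g (a ∷ x)) (m≤ᵇn∧k≡ᵇn∸m≡m+k≡ᵇn a m (sum x)) ⟩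
    𝟙 (a Nat.+ sum x ≡ᵇ m) * g (a ∷ x) ∎
    where
    keepHead-id : ∀ {d} (y : Vec ℕ (suc d)) → keepHead id y ≡ y
    keepHead-id (b ∷ y) = ≡.refl

  -- For x, y ∈ ℕ^d differing in exactly e coordinates: the number of coordinates i
  -- (resp. pairs i < j) outside which x and y agree.
  offOne : ℕ → ℕ → ℕ
  offOne d zero          = d
  offOne d (suc zero)    = 1
  offOne d (suc (suc e)) = 0

  offTwo : ℕ → ℕ → ℕ
  offTwo d zero                = d C 2
  offTwo d (suc zero)          = d ∸ 1
  offTwo d (suc (suc zero))    = 1
  offTwo d (suc (suc (suc e))) = 0

  offOne-suc : ∀ d e t → 𝟙 (e ≡ᵇ 0) + 𝟙 t * ι (offOne d e) ≈ ι (offOne (suc d) (if t then e else suc e))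
  offOne-suc d zero          true  = +-congˡ (*-identityˡ _)
  offOne-suc d (suc zero)    true  = trans (+-identityˡ _) (*-identityˡ _)
  offOne-suc d (suc (suc e)) true  = trans (+-identityˡ _) (*-identityˡ _)
  offOne-suc d zero          false = +-congˡ (zeroˡ _)
  offOne-suc d (suc zero)    false = trans (+-identityˡ _) (zeroˡ _)
  offOne-suc d (suc (suc e)) false = trans (+-identityˡ _) (zeroˡ _)

  offTwo-suc : ∀ d e t → ι (offOne (suc d) e) + 𝟙 t * ι (offTwo (suc d) e) ≈ ι (offTwo (suc (suc d)) (if t then e else suc e))
  offTwo-suc d zero                true  = begin
    ι (suc d) + 1# * ι (suc d C 2)  ≈⟨ +-congˡ (*-identityˡ _) ⟩
    ι (suc d) + ι (suc d C 2)       ≈⟨ ι-+ (suc d) (suc d C 2) ⟨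
    ι (suc d Nat.+ suc d C 2)       ≡⟨ ≡.cong ι ([1+n]C2≡n+nC2 (suc d)) ⟨
    ι (suc (suc d) C 2)             ∎
  offTwo-suc d (suc zero)          true  = trans (+-congˡ (*-identityˡ _)) (sym (ι-+ 1 d))
  offTwo-suc d (suc (suc zero))    true  = trans (+-identityˡ _) (*-identityˡ _)
  offTwo-suc d (suc (suc (suc e))) true  = trans (+-identityˡ _) (*-identityˡ _)
  offTwo-suc d e                   false = trans (+-congˡ (zeroˡ _)) (trans (+-identityʳ _) (lemma e))
    where
    lemma : ∀ e → ι (offOne (suc d) e) ≈ ι (offTwo (suc (suc d)) (suc e))
    lemma zero          = refl
    lemma (suc zero)    = refl
    lemma (suc (suc e)) = refl

  ∑-keepHead : ∀ {d} (L : List (Projection d)) a b x y →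
    ∑[ κ ← map keepHead L ] agree κ (a ∷ x) (b ∷ y) ≈ 𝟙 (a ≡ᵇ b) * ∑[ κ ← L ] agree κ x y
  ∑-keepHead L a b x y = begin
    ∑[ κ ← map keepHead L ] agree κ (a ∷ x) (b ∷ y)     ≡⟨ ∑-map keepHead L (λ κ → agree κ (a ∷ x) (b ∷ y)) ⟩
    ∑[ κ ← L ] 𝟙 ((a ≡ᵇ b) ∧ does (κ x ≟ᵥ κ y))         ≈⟨ ∑-cong L (λ κ → 𝟙-∧ (a ≡ᵇ b) (does (κ x ≟ᵥ κ y))) ⟩
    ∑[ κ ← L ] (𝟙 (a ≡ᵇ b) * agree κ x y)               ≈⟨ ∑-distribˡ L (𝟙 (a ≡ᵇ b)) (λ κ → agree κ x y) ⟩
    𝟙 (a ≡ᵇ b) * ∑[ κ ← L ] agree κ x y                 ∎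

  ∑-forgetOne : ∀ {d} (x y : Vec ℕ d) → ∑[ σ ← forgetOne d ] agree σ x y ≈ ι (offOne d (diffCount x y))
  ∑-forgetOne []      []      = refl
  ∑-forgetOne (a ∷ x) (b ∷ y) = begin
    agree id x y + ∑[ σ ← map keepHead (forgetOne _) ] agree σ (a ∷ x) (b ∷ y)
      ≈⟨ +-cong (reflexive (≡.cong 𝟙 (≟ᵥ-diffCount x y))) (∑-keepHead (forgetOne _) a b x y) ⟩
    𝟙 (diffCount x y ≡ᵇ 0) + 𝟙 (a ≡ᵇ b) * ∑[ σ ← forgetOne _ ] agree σ x y
      ≈⟨ +-congˡ (*-congˡ (∑-forgetOne x y)) ⟩
    𝟙 (diffCount x y ≡ᵇ 0) + 𝟙 (a ≡ᵇ b) * ι (offOne _ (diffCount x y))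
      ≈⟨ offOne-suc _ (diffCount x y) (a ≡ᵇ b) ⟩
    ι (offOne (suc _) (diffCount (a ∷ x) (b ∷ y))) ∎

  ∑-forgetTwo : ∀ {d} (x y : Vec ℕ d) → ∑[ κ ← forgetTwo d ] agree κ x y ≈ ι (offTwo d (diffCount x y))
  ∑-forgetTwo []            []            = refl
  ∑-forgetTwo (a ∷ [])      (b ∷ [])      = lemma (a ≡ᵇ b)
    where
    lemma : ∀ t → 0# ≈ ι (offTwo 1 (if t then 0 else 1))
    lemma true  = refl
    lemma false = refl
  ∑-forgetTwo {suc (suc d)} (a ∷ x) (b ∷ y) = begin
    ∑[ κ ← map dropHead (forgetOne (suc d)) ++ map keepHead (forgetTwo (suc d)) ] agree κ (a ∷ x) (b ∷ y)
      ≈⟨ ∑-++ (map dropHead (forgetOne (suc d))) (map keepHead (forgetTwo (suc d))) (λ κ → agree κ (a ∷ x) (b ∷ y)) ⟩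
    ∑[ κ ← map dropHead (forgetOne (suc d)) ] agree κ (a ∷ x) (b ∷ y) + ∑[ κ ← map keepHead (forgetTwo (suc d)) ] agree κ (a ∷ x) (b ∷ y)
      ≈⟨ +-cong (reflexive (∑-map dropHead (forgetOne (suc d)) (λ κ → agree κ (a ∷ x) (b ∷ y)))) (∑-keepHead (forgetTwo (suc d)) a b x y) ⟩
    ∑[ σ ← forgetOne (suc d) ] agree σ x y + 𝟙 (a ≡ᵇ b) * ∑[ κ ← forgetTwo (suc d) ] agree κ x y
      ≈⟨ +-cong (∑-forgetOne x y) (*-congˡ (∑-forgetTwo x y)) ⟩
    ι (offOne (suc d) (diffCount x y)) + 𝟙 (a ≡ᵇ b) * ι (offTwo (suc d) (diffCount x y))
      ≈⟨ offTwo-suc d (diffCount x y) (a ≡ᵇ b) ⟩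
    ι (offTwo (suc (suc d)) (diffCount (a ∷ x) (b ∷ y))) ∎

  offTwo-≢1 : ∀ d e → e ≢ 1 → ι (offTwo d e) ≈ 𝟙 (e ≡ᵇ 2) + ι (d C 2) * 𝟙 (e ≡ᵇ 0)
  offTwo-≢1 d zero                _   = sym (trans (+-identityˡ _) (*-identityʳ _))
  offTwo-≢1 d (suc zero)          e≢1 = ⊥-elim (e≢1 ≡.refl)
  offTwo-≢1 d (suc (suc zero))    _   = +-congˡ (sym (zeroʳ _))
  offTwo-≢1 d (suc (suc (suc e))) _   = sym (trans (+-identityˡ _) (zeroʳ _))

  ∑-forgetTwo-sameSum : ∀ {d} (x y : Vec ℕ d) → sum x ≡ sum y →
    ∑[ κ ← forgetTwo d ] agree κ x y ≈ 𝟙 (adjacent x y) + ι (d C 2) * 𝟙 (does (x ≟ᵥ y))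
  ∑-forgetTwo-sameSum {d} x y sx≡sy = begin
    ∑[ κ ← forgetTwo d ] agree κ x y                              ≈⟨ ∑-forgetTwo x y ⟩
    ι (offTwo d (diffCount x y))                                  ≈⟨ offTwo-≢1 d (diffCount x y) (diffCount≢1 x y sx≡sy) ⟩
    𝟙 (diffCount x y ≡ᵇ 2) + ι (d C 2) * 𝟙 (diffCount x y ≡ᵇ 0)
      ≡⟨ ≡.cong (λ b → 𝟙 (adjacent x y) + ι (d C 2) * 𝟙 b) (≟ᵥ-diffCount x y) ⟨
    𝟙 (adjacent x y) + ι (d C 2) * 𝟙 (does (x ≟ᵥ y))             ∎

  classSum-id-∈ : ∀ {d} n g {x : Vec ℕ d} → x ∈ compositions d n → classSum n id g x ≈ g x
  classSum-id-∈ n g {x} x∈V = begin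
    classSum n id g x      ≈⟨ classSum-id n g x ⟩
    𝟙 (sum x ≡ᵇ n) * g x   ≡⟨ ≡.cong (λ b → 𝟙 b * g x) (dec-true (sum x Nat.≟ n) (∈-compositions⁻ _ n x∈V)) ⟩
    1# * g x               ≈⟨ *-identityˡ (g x) ⟩
    g x                    ∎

  ∑-forgetTwo-classSum : ∀ d n {x} → x ∈ compositions d n → (v : Vec ℕ d → Carrier) →
    ∑[ κ ← forgetTwo d ] classSum n κ v x ≈ adjApply F d n v x + ι (d C 2) * v x
  ∑-forgetTwo-classSum d n {x} x∈V v = begin
    ∑[ κ ← forgetTwo d ] ∑[ y ← V ] (agree κ x y * v y)
      ≈⟨ ∑-comm (forgetTwo d) V (λ κ y → agree κ x y * v y) ⟩
    ∑[ y ← V ] ∑[ κ ← forgetTwo d ] (agree κ x y * v y)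
      ≈⟨ ∑-cong V (λ y → ∑-distribʳ (forgetTwo d) (v y) (λ κ → agree κ x y)) ⟩
    ∑[ y ← V ] ((∑[ κ ← forgetTwo d ] agree κ x y) * v y)
      ≈⟨ ∑-cong-∈ V (λ {y} y∈V → *-congʳ (∑-forgetTwo-sameSum x y
                                          (≡.trans (∈-compositions⁻ d n x∈V) (≡.sym (∈-compositions⁻ d n y∈V))))) ⟩
    ∑[ y ← V ] ((𝟙 (adjacent x y) + k * 𝟙 (does (x ≟ᵥ y))) * v y)
      ≈⟨ ∑-cong V (λ y → trans (distribʳ (v y) _ _) (+-congˡ (*-assoc _ _ _))) ⟩
    ∑[ y ← V ] (𝟙 (adjacent x y) * v y + k * (𝟙 (does (x ≟ᵥ y)) * v y))
      ≈⟨ ∑-distrib-+ V (λ y → 𝟙 (adjacent x y) * v y) (λ y → k * (𝟙 (does (x ≟ᵥ y)) * v y)) ⟩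
    adjApply F d n v x + ∑[ y ← V ] (k * (𝟙 (does (x ≟ᵥ y)) * v y))
      ≈⟨ +-congˡ (trans (∑-distribˡ V k (λ y → 𝟙 (does (x ≟ᵥ y)) * v y)) (*-congˡ (classSum-id-∈ n v x∈V))) ⟩
    adjApply F d n v x + k * v x ∎
    where
    V = compositions d n
    k = ι (d C 2)

  eigenvalue-≥ : ∀ d n {μ} → IsEigenvalueSR F d n μ → - ι (d C 2) ≤ μ
  eigenvalue-≥ d n {μ} (v , (x₀ , x₀∈V , vx₀≉0) , Av≈μv) =
    0≤x+y⇒-y≤x (nonneg-*-cancelʳ 0≤∑v² ∑v²≉0 (≤-respʳ-≈ forms≈ (∑-nonneg (forgetTwo d) (λ κ → form-nonneg κ V v))))
    where
    open module Form (κ : Projection d) = KernelForm κ _≟ᵥ_ using (form; form-nonneg)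
    V = compositions d n
    k = ι (d C 2)
    ∑v² = ∑[ x ← V ] (v x * v x)
    0≤∑v² = proj₁ (∑-squares-pos V v x₀∈V vx₀≉0)
    ∑v²≉0 = proj₂ (∑-squares-pos V v x₀∈V vx₀≉0)
    forms≈ : ∑[ κ ← forgetTwo d ] form κ V v ≈ (μ + k) * ∑v²
    forms≈ = begin
      ∑[ κ ← forgetTwo d ] ∑[ x ← V ] (v x * classSum n κ v x)
        ≈⟨ ∑-comm (forgetTwo d) V (λ κ x → v x * classSum n κ v x) ⟩
      ∑[ x ← V ] ∑[ κ ← forgetTwo d ] (v x * classSum n κ v x)
        ≈⟨ ∑-cong V (λ x → ∑-distribˡ (forgetTwo d) (v x) (λ κ → classSum n κ v x)) ⟩
      ∑[ x ← V ] (v x * ∑[ κ ← forgetTwo d ] classSum n κ v x)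
        ≈⟨ ∑-cong-∈ V (λ x∈V → *-congˡ (∑-forgetTwo-classSum d n x∈V v)) ⟩
      ∑[ x ← V ] (v x * (adjApply F d n v x + k * v x))
        ≈⟨ ∑-cong-∈ V (λ x∈V → *-congˡ (+-congʳ (Av≈μv _ x∈V))) ⟩
      ∑[ x ← V ] (v x * (μ * v x + k * v x))
        ≈⟨ ∑-cong V (λ x → trans (*-congˡ (sym (distribʳ (v x) μ k))) (x∙yz≈y∙xz (v x) (μ + k) (v x))) ⟩
      ∑[ x ← V ] ((μ + k) * (v x * v x))
        ≈⟨ ∑-distribˡ V (μ + k) (λ x → v x * v x) ⟩
      (μ + k) * ∑v² ∎

  HeadAlternating : ∀ {e} → (Vec ℕ (suc e) → Carrier) → Set
  HeadAlternating f = ∀ j t u y → f (t ∷ (y [ j ]≔ u)) ≈ - f (u ∷ (y [ j ]≔ t))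

  Alternating : ∀ d → (Vec ℕ d → Carrier) → Set
  Alternating zero    f = ⊤
  Alternating (suc d) f = HeadAlternating f × (∀ a → Alternating d (f ∘ (a ∷_)))

  -- The class of "agree off coordinates 0 and 1" is {(b, N ∸ b, z) : b ≤ N}, which
  -- b ↦ N ∸ b maps to itself while swapping the first two coordinates.
  classSum-firstPair : ∀ {e} (f : Vec ℕ (suc (suc e)) → Carrier) → HeadAlternating f →
    ∀ n a c z → classSum n (dropHead (dropHead id)) f (a ∷ c ∷ z) ≈ 0#
  classSum-firstPair f f-alt n a c z = begin
    classSum n (dropHead (dropHead id)) f (a ∷ c ∷ z)
      ≈⟨ classSum-dropHead n (dropHead id) f a (c ∷ z) ⟩
    ∑[ b < suc n ] classSum (n ∸ b) (dropHead id) (f ∘ (b ∷_)) (c ∷ z)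
      ≈⟨ ∑<-cong (suc n) (λ {b} _ → classSum-dropHead (n ∸ b) id (f ∘ (b ∷_)) c z) ⟩
    ∑[ b < suc n ] ∑[ c′ < suc (n ∸ b) ] classSum (n ∸ b ∸ c′) id (λ w → f (b ∷ c′ ∷ w)) z
      ≈⟨ ∑<-cong (suc n) (λ {b} _ → ∑<-cong (suc (n ∸ b)) (λ {c′} _ → classSum-id (n ∸ b ∸ c′) (λ w → f (b ∷ c′ ∷ w)) z)) ⟩
    ∑[ b < suc n ] ∑[ c′ < suc (n ∸ b) ] (𝟙 (s ≡ᵇ n ∸ b ∸ c′) * f (b ∷ c′ ∷ z))
      ≈⟨ ∑<-cong (suc n) (λ {b} _ → ∑<-sift-∸ (n ∸ b) s (λ c′ → f (b ∷ c′ ∷ z))) ⟩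
    ∑[ b < suc n ] (𝟙 (s ≤ᵇ n ∸ b) * f (b ∷ (n ∸ b ∸ s) ∷ z))
      ≈⟨ ∑<-from-∸ n s (λ b → f (b ∷ (n ∸ b ∸ s) ∷ z)) ⟩
    𝟙 (s ≤ᵇ n) * ∑[ b < suc N ] f (b ∷ (n ∸ b ∸ s) ∷ z)
      ≈⟨ *-congˡ (∑<-cong (suc N) (λ {b} _ → reflexive (≡.cong (λ m → f (b ∷ m ∷ z)) (∸-∸-comm n b s)))) ⟩
    𝟙 (s ≤ᵇ n) * ∑[ b < suc N ] f (b ∷ (N ∸ b) ∷ z)
      ≈⟨ *-congˡ (∑<-antipalindromic N (λ b → f (b ∷ (N ∸ b) ∷ z)) swap) ⟩
    𝟙 (s ≤ᵇ n) * 0#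
      ≈⟨ zeroʳ _ ⟩
    0# ∎
    where
    s = sum z
    N = n ∸ s
    swap : ∀ {t} → t Nat.≤ N → f (t ∷ (N ∸ t) ∷ z) ≈ - f ((N ∸ t) ∷ (N ∸ (N ∸ t)) ∷ z)
    swap {t} t≤N = trans (f-alt Fin.zero t (N ∸ t) (0 ∷ z))
                         (-‿cong (reflexive (≡.cong (λ m → f ((N ∸ t) ∷ m ∷ z)) (≡.sym (Natₚ.m∸[m∸n]≡n t≤N)))))

  classSum-headPairs : ∀ {e} (f : Vec ℕ (suc e) → Carrier) → HeadAlternating f →
    ∀ n a x → ∑[ σ ← forgetOne e ] classSum n (dropHead σ) f (a ∷ x) ≈ 0#
  classSum-headPairs f f-alt n a []      = refl
  classSum-headPairs {suc e} f f-alt n a (c ∷ z) = begin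
    classSum n (dropHead (dropHead id)) f (a ∷ c ∷ z) + ∑[ σ ← map keepHead (forgetOne e) ] classSum n (dropHead σ) f (a ∷ c ∷ z)
      ≈⟨ +-cong (classSum-firstPair f f-alt n a c z) (reflexive (∑-map keepHead (forgetOne e) _)) ⟩
    0# + ∑[ σ ← forgetOne e ] classSum n (dropHead (keepHead σ)) f (a ∷ c ∷ z)
      ≈⟨ +-identityˡ _ ⟩
    ∑[ σ ← forgetOne e ] classSum n (dropHead (keepHead σ)) f (a ∷ c ∷ z)
      ≈⟨ ∑-cong (forgetOne e) (λ σ → classSum-secondFixed σ) ⟩
    ∑[ σ ← forgetOne e ] (𝟙 (c ≤ᵇ n) * classSum (n ∸ c) (dropHead σ) f′ (a ∷ z))
      ≈⟨ ∑-distribˡ (forgetOne e) (𝟙 (c ≤ᵇ n)) (λ σ → classSum (n ∸ c) (dropHead σ) f′ (a ∷ z)) ⟩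
    𝟙 (c ≤ᵇ n) * ∑[ σ ← forgetOne e ] classSum (n ∸ c) (dropHead σ) f′ (a ∷ z)
      ≈⟨ *-congˡ (classSum-headPairs f′ (λ j t u w → f-alt (Fin.suc j) t u (c ∷ w)) (n ∸ c) a z) ⟩
    𝟙 (c ≤ᵇ n) * 0#
      ≈⟨ zeroʳ _ ⟩
    0# ∎
    where
    f′ : Vec ℕ (suc e) → Carrier
    f′ y = f (head y ∷ c ∷ tail y)
    classSum-secondFixed : ∀ σ →
      classSum n (dropHead (keepHead σ)) f (a ∷ c ∷ z) ≈ 𝟙 (c ≤ᵇ n) * classSum (n ∸ c) (dropHead σ) f′ (a ∷ z)
    classSum-secondFixed σ = begin
      classSum n (dropHead (keepHead σ)) f (a ∷ c ∷ z)
        ≈⟨ classSum-dropHead n (keepHead σ) f a (c ∷ z) ⟩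
      ∑[ b < suc n ] classSum (n ∸ b) (keepHead σ) (f ∘ (b ∷_)) (c ∷ z)
        ≈⟨ ∑<-cong (suc n) (λ {b} _ → classSum-keepHead (n ∸ b) σ (f ∘ (b ∷_)) c z) ⟩
      ∑[ b < suc n ] (𝟙 (c ≤ᵇ n ∸ b) * classSum (n ∸ b ∸ c) σ (f′ ∘ (b ∷_)) z)
        ≈⟨ ∑<-from-∸ n c (λ b → classSum (n ∸ b ∸ c) σ (f′ ∘ (b ∷_)) z) ⟩
      𝟙 (c ≤ᵇ n) * ∑[ b < suc (n ∸ c) ] classSum (n ∸ b ∸ c) σ (f′ ∘ (b ∷_)) z
        ≈⟨ *-congˡ (∑<-cong (suc (n ∸ c)) (λ {b} _ → reflexive (≡.cong (λ m → classSum m σ (f′ ∘ (b ∷_)) z) (∸-∸-comm n b c)))) ⟩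
      𝟙 (c ≤ᵇ n) * ∑[ b < suc (n ∸ c) ] classSum (n ∸ c ∸ b) σ (f′ ∘ (b ∷_)) z
        ≈⟨ *-congˡ (classSum-dropHead (n ∸ c) σ f′ a z) ⟨
      𝟙 (c ≤ᵇ n) * classSum (n ∸ c) (dropHead σ) f′ (a ∷ z) ∎

  classSum-alternating : ∀ {d} (f : Vec ℕ d → Carrier) → Alternating d f →
    ∀ n x → ∑[ κ ← forgetTwo d ] classSum n κ f x ≈ 0#
  classSum-alternating f _ n [] = refl
  classSum-alternating {suc d} f (f-alt , f∘∷-alt) n (a ∷ x) = begin
    ∑[ κ ← map dropHead (forgetOne d) ++ map keepHead (forgetTwo d) ] classSum n κ f (a ∷ x)
      ≈⟨ ∑-++ (map dropHead (forgetOne d)) (map keepHead (forgetTwo d)) (λ κ → classSum n κ f (a ∷ x)) ⟩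
    ∑[ κ ← map dropHead (forgetOne d) ] classSum n κ f (a ∷ x) + ∑[ κ ← map keepHead (forgetTwo d) ] classSum n κ f (a ∷ x)
      ≈⟨ +-cong (reflexive (∑-map dropHead (forgetOne d) (λ κ → classSum n κ f (a ∷ x))))
                (reflexive (∑-map keepHead (forgetTwo d) (λ κ → classSum n κ f (a ∷ x)))) ⟩
    ∑[ σ ← forgetOne d ] classSum n (dropHead σ) f (a ∷ x) + ∑[ κ ← forgetTwo d ] classSum n (keepHead κ) f (a ∷ x)
      ≈⟨ +-cong (classSum-headPairs f f-alt n a x) (∑-cong (forgetTwo d) (λ κ → classSum-keepHead n κ f a x)) ⟩
    0# + ∑[ κ ← forgetTwo d ] (𝟙 (a ≤ᵇ n) * classSum (n ∸ a) κ (f ∘ (a ∷_)) x)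
      ≈⟨ trans (+-identityˡ _) (∑-distribˡ (forgetTwo d) (𝟙 (a ≤ᵇ n)) (λ κ → classSum (n ∸ a) κ (f ∘ (a ∷_)) x)) ⟩
    𝟙 (a ≤ᵇ n) * ∑[ κ ← forgetTwo d ] classSum (n ∸ a) κ (f ∘ (a ∷_)) x
      ≈⟨ *-congˡ (classSum-alternating (f ∘ (a ∷_)) (f∘∷-alt a) (n ∸ a) x) ⟩
    𝟙 (a ≤ᵇ n) * 0#
      ≈⟨ zeroʳ _ ⟩
    0# ∎

  alternating-eigenvector : ∀ d n (f : Vec ℕ d → Carrier) → Alternating d f →
    ∀ x → x ∈ compositions d n → adjApply F d n f x ≈ (- ι (d C 2)) * f x
  alternating-eigenvector d n f f-alt x x∈V = begin
    Af                 ≈⟨ +-identityʳ Af ⟨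
    Af + 0#            ≈⟨ +-congˡ (-‿inverseʳ kf) ⟨
    Af + (kf + - kf)   ≈⟨ +-assoc Af kf (- kf) ⟨
    (Af + kf) + - kf   ≈⟨ +-congʳ (trans (sym (∑-forgetTwo-classSum d n x∈V f)) (classSum-alternating f f-alt n x)) ⟩
    0# + - kf          ≈⟨ +-identityˡ (- kf) ⟩
    - kf               ≈⟨ -‿distribˡ-* (ι (d C 2)) (f x) ⟩
    (- ι (d C 2)) * f x ∎
    where
    Af = adjApply F d n f x
    kf = ι (d C 2) * f x

  sgn : ℕ → ℕ → Carrier
  sgn a b = if a <ᵇ b then 1# else if b <ᵇ a then - 1# else 0#

  sgn-antisym : ∀ a b → sgn b a ≈ - sgn a b
  sgn-antisym a b with a <ᵇ b in a<ᵇb | b <ᵇ a in b<ᵇa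
  ... | true  | true  = ⊥-elim (Natₚ.<-asym (Natₚ.<ᵇ⇒< a b (≡.subst T (≡.sym a<ᵇb) _)) (Natₚ.<ᵇ⇒< b a (≡.subst T (≡.sym b<ᵇa) _)))
  ... | true  | false = refl
  ... | false | true  = sym (⁻¹-involutive 1#)
  ... | false | false = sym ε⁻¹≈ε

  sgn-< : ∀ {a b} → a Nat.< b → sgn a b ≡ 1#
  sgn-< {a} {b} a<b with a <ᵇ b | Natₚ.<⇒<ᵇ a<b
  ... | true | _ = ≡.refl

  ∏ : ∀ {d} → (ℕ → Carrier) → Vec ℕ d → Carrier
  ∏ h []      = 1#
  ∏ h (b ∷ y) = h b * ∏ h y

  ∏-headExchange : ∀ {e} (h : ℕ → Carrier) j t u (y : Vec ℕ e) → ∏ h (t ∷ (y [ j ]≔ u)) ≈ ∏ h (u ∷ (y [ j ]≔ t))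
  ∏-headExchange h Fin.zero    t u (b ∷ y) = x∙yz≈y∙xz (h t) (h u) (∏ h y)
  ∏-headExchange h (Fin.suc j) t u (b ∷ y) = begin
    h t * (h b * ∏ h (y [ j ]≔ u)) ≈⟨ x∙yz≈y∙xz (h t) (h b) _ ⟩
    h b * (h t * ∏ h (y [ j ]≔ u)) ≈⟨ *-congˡ (∏-headExchange h j t u y) ⟩
    h b * (h u * ∏ h (y [ j ]≔ t)) ≈⟨ x∙yz≈y∙xz (h b) (h u) _ ⟩
    h u * (h b * ∏ h (y [ j ]≔ t)) ∎

  ∏-sgn-< : ∀ {d a} {y : Vec ℕ d} → All (a Nat.<_) y → ∏ (sgn a) y ≈ 1#
  ∏-sgn-< []           = refl
  ∏-sgn-< (a<b ∷ a<y) = trans (*-cong (reflexive (sgn-< a<b)) (∏-sgn-< a<y)) (*-identityˡ 1#)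

  Alternating-cong : ∀ d {g h : Vec ℕ d → Carrier} → (∀ y → g y ≈ h y) → Alternating d g → Alternating d h
  Alternating-cong zero    g≈h _               = _
  Alternating-cong (suc d) g≈h (g-alt , g∘∷-alt) =
    (λ j t u y → trans (sym (g≈h _)) (trans (g-alt j t u y) (-‿cong (g≈h _)))) ,
    (λ a → Alternating-cong d (g≈h ∘ (a ∷_)) (g∘∷-alt a))

  Alternating-*ˡ : ∀ d c {g : Vec ℕ d → Carrier} → Alternating d g → Alternating d (λ y → c * g y)
  Alternating-*ˡ zero    c _                 = _
  Alternating-*ˡ (suc d) c (g-alt , g∘∷-alt) =
    (λ j t u y → trans (*-congˡ (g-alt j t u y)) (sym (-‿distribʳ-* c _))) ,
    (λ a → Alternating-*ˡ d c (g∘∷-alt a))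

  Alternating-∏* : ∀ d (h : ℕ → Carrier) {g : Vec ℕ d → Carrier} → Alternating d g → Alternating d (λ y → ∏ h y * g y)
  Alternating-∏* zero    h _                 = _
  Alternating-∏* (suc d) h (g-alt , g∘∷-alt) =
    (λ j t u y → trans (*-cong (∏-headExchange h j t u y) (g-alt j t u y)) (sym (-‿distribʳ-* _ _))) ,
    (λ b → Alternating-cong d (λ y → sym (*-assoc (h b) (∏ h y) _)) (Alternating-*ˡ d (h b) (Alternating-∏* d h (g∘∷-alt b))))

  vandermonde : ∀ {d} → Vec ℕ d → Carrier
  vandermonde []      = 1#
  vandermonde (a ∷ y) = ∏ (sgn a) y * vandermonde y

  vandermonde-swap : ∀ {d} a b (w : Vec ℕ d) → vandermonde (a ∷ b ∷ w) ≈ - vandermonde (b ∷ a ∷ w)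
  vandermonde-swap a b w = begin
    (sgn a b * pa) * (pb * v)         ≈⟨ *-interchange (sgn a b) pa pb v ⟩
    (sgn a b * pb) * (pa * v)         ≈⟨ ⁻¹-involutive _ ⟨
    - (- ((sgn a b * pb) * (pa * v))) ≈⟨ -‿cong (trans (-‿distribˡ-* _ _) (*-congʳ (-‿distribˡ-* _ _))) ⟩
    - ((- sgn a b * pb) * (pa * v))   ≈⟨ -‿cong (*-congʳ (*-congʳ (sgn-antisym a b))) ⟨
    - ((sgn b a * pb) * (pa * v))     ∎
    where
    pa = ∏ (sgn a) w
    pb = ∏ (sgn b) w
    v  = vandermonde w

  -- The transposition (0, j+2) is conjugate by (0 1) to (1, j+2).
  vandermonde-headAlternating : ∀ {d} → HeadAlternating (vandermonde {suc d})
  vandermonde-headAlternating Fin.zero    t u (c ∷ w) = vandermonde-swap t u w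
  vandermonde-headAlternating (Fin.suc j) t u (c ∷ w) = begin
    vandermonde (t ∷ c ∷ wᵤ)                        ≈⟨ vandermonde-swap t c wᵤ ⟩
    - (∏ (sgn c) (t ∷ wᵤ) * vandermonde (t ∷ wᵤ))
      ≈⟨ -‿cong (*-cong (∏-headExchange (sgn c) j t u w) (vandermonde-headAlternating j t u w)) ⟩
    - (∏ (sgn c) (u ∷ wₜ) * - vandermonde (u ∷ wₜ)) ≈⟨ -‿cong (-‿distribʳ-* _ _) ⟨
    - (- vandermonde (c ∷ u ∷ wₜ))                  ≈⟨ ⁻¹-involutive _ ⟩
    vandermonde (c ∷ u ∷ wₜ)                        ≈⟨ vandermonde-swap c u wₜ ⟩
    - vandermonde (u ∷ c ∷ wₜ)                      ∎
    where
    wᵤ = w [ j ]≔ u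
    wₜ = w [ j ]≔ t

  vandermonde-alternating : ∀ d → Alternating d vandermonde
  vandermonde-alternating zero    = _
  vandermonde-alternating (suc d) = vandermonde-headAlternating , λ a → Alternating-∏* d (sgn a) (vandermonde-alternating d)

  vandermonde-staircase : ∀ d c m → vandermonde (staircase d c m) ≈ 1#
  vandermonde-staircase zero    c m = *-identityˡ 1#
  vandermonde-staircase (suc d) c m =
    trans (*-cong (∏-sgn-< (staircase-≥ d (suc c) m)) (vandermonde-staircase d (suc c) m)) (*-identityˡ 1#)

open import Data.Nat using (_≤_; _≥_)

proposition3p5 : (F : OrderedField) → (d n : ℕ) → 1 ≤ d → n ≥ d C 2 →
    IsSmallestEigenvalueSR F d n (OrderedField.-_ F (ιℕ F (d C 2)))
proposition3p5 F (suc d) n _ k≤n = vandermonde-eigenvector , λ _ → eigenvalue-≥ (suc d) n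
  where
  open OrderedField F using (0#; -_; _≉_; trans; sym; nontrivial)
  open SR F
  open Compositions
  x₀ = staircase d 0 (n Nat.∸ suc d C 2)
  vandermonde-x₀≉0 : vandermonde x₀ ≉ 0#
  vandermonde-x₀≉0 v≈0 = nontrivial (trans (sym (vandermonde-staircase d 0 _)) v≈0)
  vandermonde-eigenvector : IsEigenvalueSR F (suc d) n (- ι (suc d C 2))
  vandermonde-eigenvector =
    vandermonde , (x₀ , staircase∈compositions d n k≤n , vandermonde-x₀≉0) ,
    alternating-eigenvector (suc d) n vandermonde (vandermonde-alternating (suc d))
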